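{- Let $\Gamma=(V,E,o,t)$ be a connected locally finite graph. Then the map $\iota_0\colon\mathbb{Z}[V]\to\mathbb{Z}^V$ induces homomorphisms $\iota\colon\mathrm{Cl}(\Gamma)\to\widehat{\mathrm{Cl}}(\Gamma)$ and $\iota^0\colon\mathrm{Cl}^0(\Gamma)\to\widehat{\mathrm{Cl}}{}^0(\Gamma)$ compatible with the inclusions $\mathrm{Cl}^0(\Gamma)\subset\mathrm{Cl}(\Gamma)$, $\widehat{\mathrm{Cl}}{}^0(\Gamma)\subset\widehat{\mathrm{Cl}}(\Gamma)$, and $\chi\circ\zeta\circ\mathrm{AJ}=\iota^0$. If $\Gamma$ is finite, then $\iota$, $\iota^0$ and $\zeta$ are isomorphisms.
   Context: Graph: $V\ne\emptyset$, $E$, $o,t\colon E\to V$, locally finite, countable. $\partial=t-o\colon\mathbb{Z}[E]\to\mathbb{Z}[V]$, $H_1(\Gamma)=\ker\partial$; $\partial^*\colon\mathbb{Z}[V]\to\mathbb{Z}[E]$, $v\mapsto\sum_{t(e)=v}e-\sum_{o(e)=v}e$; $\Delta_0=\partial\partial^*$. $d\colon\mathbb{Z}^V\to\mathbb{Z}^E$, $(df)(e)=f(t(e))-f(o(e))$, $H^1(\Gamma)=\mathbb{Z}^E/d\mathbb{Z}^V=\mathrm{Hom}(H_1(\Gamma),\mathbb{Z})$; $d^*\colon\mathbb{Z}^E\to\mathbb{Z}^V$, $(d^*\omega)(v)=\sum_{t(e)=v}\omega(e)-\sum_{o(e)=v}\omega(e)$; $\square_0=d^*d$; $\mathcal{H}^1(\Gamma)=\ker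 d^*$. $\iota_0,\iota_1$ send a vertex/edge to its characteristic function. Class groups: $\mathrm{Cl}(\Gamma)=\mathbb{Z}[V]/\Delta_0\mathbb{Z}[V]\supset\mathrm{Cl}^0(\Gamma)=\mathbb{Z}[V]_0/\Delta_0\mathbb{Z}[V]$; $\widehat{\mathrm{Cl}}(\Gamma)=\mathbb{Z}^V/\square_0\mathbb{Z}^V\supset\widehat{\mathrm{Cl}}{}^0(\Gamma)=\operatorname{im}(d^*)/\square_0\mathbb{Z}^V$. $M^\vee=\mathrm{Hom}(M,\mathbb{Z})$; $\alpha\colon H_1\to\mathcal{H}^1(\Gamma)^\vee$, $\gamma\mapsto(\omega\mapsto\omega(\gamma))$; $\beta\colon\mathcal{H}^1\to H^1$ natural map. $\mathrm{J}(\Gamma)=\mathcal{H}^1(\Gamma)^\vee/\alpha(H_1)$, $\mathrm{P}(\Gamma)=H^1(\Gamma)/\beta(\mathcal{H}^1)$. $\mathrm{AJ}\colon\mathrm{Cl}^0(\Gamma)\to\mathrm{J}(\Gamma)$ sends the class of $D=\partial\gamma$ to the class of $\omega\mapsto\omega(\gamma)$ (an isomorphism). $\zeta\colon\mathrm{J}(\Gamma)\to\mathrm{P}(\Gamma)$ is induced by the transpose ${}^t\iota\colon\mathcal{H}^1(\Gamma)^\vee\to\mathrm{Hom}(H_1,\mathbb{Z})=H^1(\Gamma)$ of $\iota_1|_{H_1}\colon H_1(\Gamma)\to\mathcal{H}^1(\Gamma)$. $\chi\colon\mathrm{P}(\Gamma)\to\widehat{\mathrm{Cl}}{}^0(\Gamma)$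 is the isomorphism induced by $d^*$. -}

module Defs where

open import Data.Nat as ℕ using (ℕ)
open import Data.Integer using (ℤ; _+_; -_; _-_; 0ℤ)
open import Data.List using (List; []; _∷_; _++_; map; concatMap)
open import Data.List.Membership.Propositional using (_∈_)
open import Data.List.Relation.Unary.Unique.Propositional using (Unique)
open import Data.Product using (Σ; ∃; _×_; _,_; proj₁; proj₂)
open import Function using (_∘_)
open import Relation.Nullary using (Dec; yes; no)
open import Relation.Binary.PropositionalEquality using (_≡_; refl; cong; sym)

-- Graphs  Γ = (V, E, o, t): V ≠ ∅, countable (injection into ℕ),
-- locally finite (for every vertex the edges ending / starting there
-- are enumerated by a finite duplicate-free list).

record Graph : Set₁ where
  field
    V E   : Set
    o t   : E → V
    base  : V
    vIdx  : V → ℕ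
    vIdx-inj : ∀ {u v} → vIdx u ≡ vIdx v → u ≡ v
    eIdx  : E → ℕ
    eIdx-inj : ∀ {e f} → eIdx e ≡ eIdx f → e ≡ f
    inc   : V → List E
    inc-complete : ∀ e → e ∈ inc (t e)
    inc-sound    : ∀ v e → e ∈ inc v → t e ≡ v
    inc-unique   : ∀ v → Unique (inc v)
    out   : V → List E
    out-complete : ∀ e → e ∈ out (o e)
    out-sound    : ∀ v e → e ∈ out v → o e ≡ v
    out-unique   : ∀ v → Unique (out v)

decFromInj : {A : Set} (f : A → ℕ) → (∀ {x y} → f x ≡ f y → x ≡ y) →
             (x y : A) → Dec (x ≡ y)
decFromInj f inj x y with f x ℕ.≟ f y
... | yes p = yes (inj p)
... | no ¬p = no (λ q → ¬p (cong f q))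

-- Free abelian group ℤ[A] as formal finite sums  Σ nᵢ·aᵢ  (lists),
-- two formal sums being equal iff their coefficient functions agree.

FSum : Set → Set
FSum A = List (ℤ × A)

neg : {A : Set} → FSum A → FSum A
neg = map (λ p → (- proj₁ p , proj₂ p))

-- coefficient function = characteristic-function map  ι : ℤ[A] → ℤ^A
coeff : {A : Set} → ((x y : A) → Dec (x ≡ y)) → FSum A → A → ℤ
coeff _≟_ [] x = 0ℤ
coeff _≟_ ((n , y) ∷ D) x with y ≟ x
... | yes _ = n + coeff _≟_ D x
... | no  _ = coeff _≟_ D x

pair : {A : Set} → (A → ℤ) → FSum A → ℤ
pair ω [] = 0ℤ
pair ω ((n , a) ∷ γ) = n Data.Integer.* ω a + pair ω γ

deg : {A : Set} → FSum A → ℤ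
deg [] = 0ℤ
deg ((n , _) ∷ D) = n + deg D

sumL : {A : Set} → (A → ℤ) → List A → ℤ
sumL f [] = 0ℤ
sumL f (x ∷ xs) = f x + sumL f xs

module _ (Γ : Graph) where
  open Graph Γ

  _≟V_ : (u v : V) → Dec (u ≡ v)
  _≟V_ = decFromInj vIdx vIdx-inj

  _≟E_ : (e f : E) → Dec (e ≡ f)
  _≟E_ = decFromInj eIdx eIdx-inj

  ZV ZE : Set
  ZV = FSum V
  ZE = FSum E

  ι₀ : ZV → V → ℤ
  ι₀ = coeff _≟V_

  ι₁ : ZE → E → ℤ
  ι₁ = coeff _≟E_

  ∂ : ZE → ZV
  ∂ = concatMap (λ p → (proj₁ p , t (proj₂ p)) ∷ (- proj₁ p , o (proj₂ p)) ∷ [])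

  ∂* : ZV → ZE
  ∂* = concatMap (λ p → map (λ e → (proj₁ p , e)) (inc (proj₂ p))
                      ++ map (λ e → (- proj₁ p , e)) (out (proj₂ p)))

  Δ₀ : ZV → ZV
  Δ₀ = ∂ ∘ ∂*

  d : (V → ℤ) → (E → ℤ)
  d f e = f (t e) - f (o e)

  d* : (E → ℤ) → (V → ℤ)
  d* ω v = sumL ω (inc v) - sumL ω (out v)

  □₀ : (V → ℤ) → (V → ℤ)
  □₀ = d* ∘ d

  InH₁ : ZE → Set
  InH₁ γ = ∀ v → ι₀ (∂ γ) v ≡ 0ℤ

  Harmonic : (E → ℤ) → Set
  Harmonic ω = ∀ v → d* ω v ≡ 0ℤ

  record HarmDual : Set where
    field
      φ : (ω : E → ℤ) → Harmonic ω → ℤ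
      φ-ext : ∀ ω ω' (h : Harmonic ω) (h' : Harmonic ω') →
              (∀ e → ω e ≡ ω' e) → φ ω h ≡ φ ω' h'
      φ-add : ∀ ω ω' (h : Harmonic ω) (h' : Harmonic ω')
              (h'' : Harmonic (λ e → ω e + ω' e)) →
              φ (λ e → ω e + ω' e) h'' ≡ φ ω h + φ ω' h'
  open HarmDual public

  -- Cl(Γ) = ℤ[V]/Δ₀ℤ[V]   (Cl⁰: same relation on degree-0 divisors)
  _~Cl_ : ZV → ZV → Set
  D ~Cl D' = Σ ZV λ F → ∀ v → ι₀ D v ≡ ι₀ D' v + ι₀ (Δ₀ F) v

  -- Ĉl(Γ) = ℤ^V/□₀ℤ^V   (Ĉl⁰: same relation on im d*)
  _~Ĉl_ : (V → ℤ) → (V → ℤ) → Set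
  f ~Ĉl g = Σ (V → ℤ) λ h → ∀ v → f v ≡ g v + □₀ h v

  -- carrier of Ĉl⁰: im(d*)
  InImD* : (V → ℤ) → Set
  InImD* f = Σ (E → ℤ) λ ω → ∀ v → d* ω v ≡ f v

  -- J(Γ) = 𝓗¹^∨ / α(H₁):  φ ~ ψ  iff  φ − ψ = α(c), c ∈ H₁
  _~J_ : HarmDual → HarmDual → Set
  Φ ~J Ψ = Σ ZE λ c → InH₁ c ×
           (∀ ω (h : Harmonic ω) → φ Φ ω h ≡ φ Ψ ω h + pair ω c)

  -- AJ(D) is the class of ω ↦ ω(γ) for D = ∂γ; "Φ represents AJ(∂γ)":
  RepAJ : ZE → HarmDual → Set
  RepAJ γ Φ = Σ ZE λ c → InH₁ c ×
              (∀ ω (h : Harmonic ω) → φ Φ ω h ≡ pair ω γ + pair ω c)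

  -- P(Γ) = H¹/β(𝓗¹) with H¹ = ℤ^E/dℤ^V
  _~P_ : (E → ℤ) → (E → ℤ) → Set
  ω ~P ω' = Σ (V → ℤ) λ f → Σ (E → ℤ) λ η → Harmonic η ×
            (∀ e → ω e ≡ ω' e + d f e + η e)

  -- ζ : J → P, induced by ᵗι : 𝓗¹^∨ → Hom(H₁,ℤ) = H¹ = ℤ^E/dℤ^V.
  -- ZetaRel Φ ω : the class of ω ∈ ℤ^E corresponds to ᵗι(Φ) = Φ ∘ ι₁|H₁,
  -- i.e. ω(c) = Φ(ι₁ c) for all c ∈ H₁.
  ZetaRel : HarmDual → (E → ℤ) → Set
  ZetaRel Φ ω = ∀ c → InH₁ c → (h : Harmonic (ι₁ c)) → pair ω c ≡ φ Φ (ι₁ c) h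

  data Walk : V → V → Set where
    nil  : ∀ {v} → Walk v v
    fwd  : ∀ {w} (e : E) → Walk (t e) w → Walk (o e) w
    bwd  : ∀ {w} (e : E) → Walk (o e) w → Walk (t e) w

  Connected : Set
  Connected = ∀ u v → Walk u v

  Finite : Set
  Finite = (Σ (List V) λ vs → ∀ v → v ∈ vs) × (Σ (List E) λ es → ∀ e → e ∈ es)

-- Everything is a pairing of cochains ℤ^A with formal sums ℤ[A]: ι₀ and ι₁ are the
-- coefficient functions, ∂ and ∂* are adjoint to d and d*, and local finiteness gives
-- d*(δₑ) = δ_{t e} − δ_{o e}.  Hence ι₀∂ = d*ι₁ and ι₁∂* = dι₀, so ι₀Δ₀ = □₀ι₀ and ι
-- descends to class groups.  Connectedness provides a path from a base point to every
-- vertex; these fill degree-zero divisors (so ι⁰ lands in im d*) and close every edge e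
-- into a cycle, which shows that cochains agreeing on H₁ differ by a coboundary.  That
-- one fact makes ζ well defined (ζ(Φ) is represented by e ↦ Φ(ι₁ cycle e), using that Φ
-- is ℤ-linear) and gives χ ∘ ζ ∘ AJ = ι⁰.  On a finite graph every function is a
-- coefficient function, which inverts ι, ι⁰ and ζ.

module Submission where

open import Defs
import Data.Nat as ℕ
open import Data.Integer as ℤ using (ℤ; -[1+_]; _+_; _-_; -_; _*_; 0ℤ; 1ℤ)
open import Data.Integer.Properties
  using (+-identityˡ; +-identityʳ; +-inverseʳ; +-assoc; *-identityˡ; *-identityʳ; *-zeroʳ;
         *-distribˡ-+; suc-*; neg-distribˡ-*; +-0-abelianGroup)
open import Algebra.Properties.AbelianGroup +-0-abelianGroup using (identityˡ-unique; inverseʳ-unique)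
open import Data.Integer.Tactic.RingSolver using (solve-∀)
open import Data.List using (List; []; _∷_; _++_; map; concatMap)
open import Data.List.Membership.Propositional using (_∈_; _∉_)
open import Data.List.Membership.Propositional.Properties using (∈-map⁺)
open import Data.List.Relation.Unary.Any using (here; there)
open import Data.List.Relation.Unary.All.Properties using (All¬⇒¬Any)
open import Data.List.Relation.Unary.AllPairs using (_∷_)
open import Data.List.Relation.Unary.Unique.Propositional using (Unique)
open import Data.Product using (Σ; _×_; _,_; proj₁; proj₂)
open import Relation.Nullary using (Dec; yes; no; ¬_; contradiction)
open import Relation.Binary.Definitions using (DecidableEquality)
open import Relation.Binary.PropositionalEquality
open ≡-Reasoning
open import Function using (_∘_)

module _ {A : Set} where

  scale : ℤ → FSum A → FSum A
  scale k = map (λ (n , a) → (k * n , a))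

  pair-cong-on : ∀ {ω ω' : A → ℤ} D → (∀ {n a} → (n , a) ∈ D → ω a ≡ ω' a) →
                 pair ω D ≡ pair ω' D
  pair-cong-on []            eq = refl
  pair-cong-on ((n , a) ∷ D) eq =
    cong₂ (λ x y → n * x + y) (eq (here refl)) (pair-cong-on D (λ m → eq (there m)))

  pair-cong : ∀ {ω ω' : A → ℤ} D → (∀ a → ω a ≡ ω' a) → pair ω D ≡ pair ω' D
  pair-cong D eq = pair-cong-on D (λ {_} {a} _ → eq a)

  pair-++ : ∀ (ω : A → ℤ) D D' → pair ω (D ++ D') ≡ pair ω D + pair ω D'
  pair-++ ω []            D' = sym (+-identityˡ _)
  pair-++ ω ((n , a) ∷ D) D' =
    trans (cong ((n * ω a) +_) (pair-++ ω D D')) (sym (+-assoc (n * ω a) (pair ω D) (pair ω D')))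

  pair-+ : ∀ (ω ω' : A → ℤ) D → pair (λ a → ω a + ω' a) D ≡ pair ω D + pair ω' D
  pair-+ ω ω' []            = refl
  pair-+ ω ω' ((n , a) ∷ D) =
    trans (cong ((n * (ω a + ω' a)) +_) (pair-+ ω ω' D)) (distrib n (ω a) (ω' a) (pair ω D) (pair ω' D))
    where distrib : ∀ n x y p q → n * (x + y) + (p + q) ≡ (n * x + p) + (n * y + q)
          distrib = solve-∀

  pair-− : ∀ (ω ω' : A → ℤ) D → pair (λ a → ω a - ω' a) D ≡ pair ω D - pair ω' D
  pair-− ω ω' []            = refl
  pair-− ω ω' ((n , a) ∷ D) =
    trans (cong ((n * (ω a - ω' a)) +_) (pair-− ω ω' D)) (distrib n (ω a) (ω' a) (pair ω D) (pair ω' D))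
    where distrib : ∀ n x y p q → n * (x - y) + (p - q) ≡ (n * x + p) - (n * y + q)
          distrib = solve-∀

  pair-* : ∀ k (ω : A → ℤ) D → pair (λ a → k * ω a) D ≡ k * pair ω D
  pair-* k ω []            = sym (*-zeroʳ k)
  pair-* k ω ((n , a) ∷ D) =
    trans (cong ((n * (k * ω a)) +_) (pair-* k ω D)) (distrib n k (ω a) (pair ω D))
    where distrib : ∀ n k x p → n * (k * x) + k * p ≡ k * (n * x + p)
          distrib = solve-∀

  pair-const : ∀ k (D : FSum A) → pair (λ _ → k) D ≡ deg D * k
  pair-const k []            = refl
  pair-const k ((n , a) ∷ D) =
    trans (cong ((n * k) +_) (pair-const k D)) (distrib n (deg D) k)
    where distrib : ∀ n m k → n * k + m * k ≡ (n + m) * k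
          distrib = solve-∀

  pair-scale : ∀ (ω : A → ℤ) k D → pair ω (scale k D) ≡ k * pair ω D
  pair-scale ω k []            = sym (*-zeroʳ k)
  pair-scale ω k ((n , a) ∷ D) =
    trans (cong (((k * n) * ω a) +_) (pair-scale ω k D)) (distrib k n (ω a) (pair ω D))
    where distrib : ∀ k n x p → (k * n) * x + k * p ≡ k * (n * x + p)
          distrib = solve-∀

  pair-neg : ∀ (ω : A → ℤ) D → pair ω (neg D) ≡ - pair ω D
  pair-neg ω []            = refl
  pair-neg ω ((n , a) ∷ D) =
    trans (cong (((- n) * ω a) +_) (pair-neg ω D)) (distrib n (ω a) (pair ω D))
    where distrib : ∀ n x p → (- n) * x + (- p) ≡ - (n * x + p)
          distrib = solve-∀

  pair-map-const : ∀ (ω : A → ℤ) k (l : List A) → pair ω (map (k ,_) l) ≡ k * sumL ω l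
  pair-map-const ω k []      = sym (*-zeroʳ k)
  pair-map-const ω k (a ∷ l) =
    trans (cong ((k * ω a) +_) (pair-map-const ω k l)) (sym (*-distribˡ-+ k (ω a) (sumL ω l)))

  pair-zero : ∀ (D : FSum A) → pair (λ _ → 0ℤ) D ≡ 0ℤ
  pair-zero D = trans (pair-const 0ℤ D) (*-zeroʳ (deg D))

module _ {A B : Set} where

  pair-comm : ∀ (ω : A → B → ℤ) (D : FSum A) (D' : FSum B) →
              pair (λ a → pair (ω a) D') D ≡ pair (λ b → pair (λ a → ω a b) D) D'
  pair-comm ω []            D' = sym (pair-zero D')
  pair-comm ω ((n , a) ∷ D) D' = begin
    n * pair (ω a) D' + pair (λ a → pair (ω a) D') D
      ≡⟨ cong₂ _+_ (sym (pair-* n (ω a) D')) (pair-comm ω D D') ⟩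
    pair (λ b → n * ω a b) D' + pair (λ b → pair (λ a → ω a b) D) D'
      ≡⟨ sym (pair-+ _ _ D') ⟩
    pair (λ b → n * ω a b + pair (λ a → ω a b) D) D' ∎

  extend : (A → FSum B) → FSum A → FSum B
  extend f = concatMap (λ (n , a) → scale n (f a))

  pair-extend : ∀ (ω : B → ℤ) f D → pair ω (extend f D) ≡ pair (λ a → pair ω (f a)) D
  pair-extend ω f []            = refl
  pair-extend ω f ((n , a) ∷ D) = begin
    pair ω (scale n (f a) ++ extend f D)
      ≡⟨ pair-++ ω (scale n (f a)) (extend f D) ⟩
    pair ω (scale n (f a)) + pair ω (extend f D)
      ≡⟨ cong₂ _+_ (pair-scale ω n (f a)) (pair-extend ω f D) ⟩
    n * pair ω (f a) + pair (λ a → pair ω (f a)) D ∎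

module DecEqSums {A : Set} (_≟_ : DecidableEquality A) where

  δ : A → A → ℤ
  δ x y with x ≟ y
  ... | yes _ = 1ℤ
  ... | no  _ = 0ℤ

  δ-≡ : ∀ {x y} → x ≡ y → δ x y ≡ 1ℤ
  δ-≡ {x} {y} x≡y with x ≟ y
  ... | yes _   = refl
  ... | no  x≢y = contradiction x≡y x≢y

  δ-≢ : ∀ {x y} → ¬ x ≡ y → δ x y ≡ 0ℤ
  δ-≢ {x} {y} x≢y with x ≟ y
  ... | yes x≡y = contradiction x≡y x≢y
  ... | no  _   = refl

  δ-sym : ∀ x y → δ x y ≡ δ y x
  δ-sym x y with x ≟ y
  ... | yes x≡y = sym (δ-≡ (sym x≡y))
  ... | no  x≢y = sym (δ-≢ (x≢y ∘ sym))

  coeff-δ : ∀ D x → coeff _≟_ D x ≡ pair (λ y → δ y x) D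
  coeff-δ []            x = refl
  coeff-δ ((n , y) ∷ D) x with y ≟ x
  ... | yes _ = trans (cong (n +_) (coeff-δ D x)) (cong (_+ _) (sym (*-identityʳ n)))
  ... | no  _ = trans (coeff-δ D x) (sym (trans (cong (_+ _) (*-zeroʳ n)) (+-identityˡ _)))

  pair-coeff-comm : ∀ D D' → pair (coeff _≟_ D) D' ≡ pair (coeff _≟_ D') D
  pair-coeff-comm D D' = begin
    pair (coeff _≟_ D) D'
      ≡⟨ pair-cong D' (coeff-δ D) ⟩
    pair (λ x → pair (λ y → δ y x) D) D'
      ≡⟨ sym (pair-comm δ D D') ⟩
    pair (λ y → pair (δ y) D') D
      ≡⟨ pair-cong D (λ y → pair-cong D' (δ-sym y)) ⟩
    pair (λ y → pair (λ x → δ x y) D') D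
      ≡⟨ sym (pair-cong D (coeff-δ D')) ⟩
    pair (coeff _≟_ D') D ∎

  coeff-++ : ∀ D D' x → coeff _≟_ (D ++ D') x ≡ coeff _≟_ D x + coeff _≟_ D' x
  coeff-++ D D' x = begin
    coeff _≟_ (D ++ D') x                          ≡⟨ coeff-δ (D ++ D') x ⟩
    pair (λ y → δ y x) (D ++ D')                   ≡⟨ pair-++ _ D D' ⟩
    pair (λ y → δ y x) D + pair (λ y → δ y x) D'   ≡⟨ sym (cong₂ _+_ (coeff-δ D x) (coeff-δ D' x)) ⟩
    coeff _≟_ D x + coeff _≟_ D' x                 ∎

  coeff-scale : ∀ k D x → coeff _≟_ (scale k D) x ≡ k * coeff _≟_ D x
  coeff-scale k D x = begin
    coeff _≟_ (scale k D) x          ≡⟨ coeff-δ (scale k D) x ⟩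
    pair (λ y → δ y x) (scale k D)   ≡⟨ pair-scale _ k D ⟩
    k * pair (λ y → δ y x) D         ≡⟨ sym (cong (k *_) (coeff-δ D x)) ⟩
    k * coeff _≟_ D x                ∎

  -- Each entry compensates for the later ones, so repetitions in the list are harmless.
  fromFunction : (A → ℤ) → List A → FSum A
  fromFunction g []       = []
  fromFunction g (x ∷ xs) = (g x - coeff _≟_ (fromFunction g xs) x , x) ∷ fromFunction g xs

  private
    +-minus-cancel : ∀ a b → (a - b) + b ≡ a
    +-minus-cancel = solve-∀

  coeff-fromFunction : ∀ g xs {x} → x ∈ xs → coeff _≟_ (fromFunction g xs) x ≡ g x
  coeff-fromFunction g (y ∷ ys) {x} x∈ with y ≟ x
  coeff-fromFunction g (y ∷ ys) {x} x∈        | yes refl = +-minus-cancel (g y) (coeff _≟_ (fromFunction g ys) y)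
  coeff-fromFunction g (y ∷ ys) {x} (here x≡y) | no  y≢x = contradiction (sym x≡y) y≢x
  coeff-fromFunction g (y ∷ ys) {x} (there x∈) | no  _   = coeff-fromFunction g ys x∈

  pair-null : ∀ (g : A → ℤ) D → (∀ x → coeff _≟_ D x ≡ 0ℤ) → pair g D ≡ 0ℤ
  pair-null g D null = begin
    pair g D                   ≡⟨ pair-cong-on D (λ m → sym (coeff-fromFunction g support (∈-map⁺ proj₂ m))) ⟩
    pair (coeff _≟_ ĝ) D       ≡⟨ pair-coeff-comm ĝ D ⟩
    pair (coeff _≟_ D) ĝ       ≡⟨ pair-cong ĝ null ⟩
    pair (λ _ → 0ℤ) ĝ          ≡⟨ pair-zero ĝ ⟩
    0ℤ                         ∎
    where
    support = map proj₂ D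
    ĝ       = fromFunction g support

  sumL-δ-∉ : ∀ {x} l → x ∉ l → sumL (δ x) l ≡ 0ℤ
  sumL-δ-∉ []      x∉ = refl
  sumL-δ-∉ (y ∷ l) x∉ = cong₂ _+_ (δ-≢ (x∉ ∘ here)) (sumL-δ-∉ l (x∉ ∘ there))

  sumL-δ-∈ : ∀ {x} l → Unique l → x ∈ l → sumL (δ x) l ≡ 1ℤ
  sumL-δ-∈ (y ∷ l) (y∉l ∷ _) (here refl) = cong₂ _+_ (δ-≡ refl) (sumL-δ-∉ l (All¬⇒¬Any y∉l))
  sumL-δ-∈ (y ∷ l) (y∉l ∷ u) (there x∈) =
    cong₂ _+_ (δ-≢ (λ { refl → All¬⇒¬Any y∉l x∈ })) (sumL-δ-∈ l u x∈)

module GraphCalculus (Γ : Graph) where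
  open Graph Γ

  module OnV = DecEqSums (_≟V_ Γ)
  module OnE = DecEqSums (_≟E_ Γ)

  pair-∂ : ∀ (f : V → ℤ) x → pair f (∂ Γ x) ≡ pair (d Γ f) x
  pair-∂ f []            = refl
  pair-∂ f ((n , e) ∷ x) =
    trans (cong (λ p → n * f (t e) + ((- n) * f (o e) + p)) (pair-∂ f x))
          (distrib n (f (t e)) (f (o e)) (pair (d Γ f) x))
    where distrib : ∀ n a b p → n * a + ((- n) * b + p) ≡ n * (a - b) + p
          distrib = solve-∀

  pair-∂* : ∀ (ω : E → ℤ) F → pair ω (∂* Γ F) ≡ pair (d* Γ ω) F
  pair-∂* ω []            = refl
  pair-∂* ω ((n , v) ∷ F) = begin
    pair ω ((ins ++ outs) ++ ∂* Γ F)
      ≡⟨ pair-++ ω (ins ++ outs) (∂* Γ F) ⟩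
    pair ω (ins ++ outs) + pair ω (∂* Γ F)
      ≡⟨ cong₂ _+_ (pair-++ ω ins outs) (pair-∂* ω F) ⟩
    (pair ω ins + pair ω outs) + pair (d* Γ ω) F
      ≡⟨ cong (_+ _) (cong₂ _+_ (pair-map-const ω n (inc v)) (pair-map-const ω (- n) (out v))) ⟩
    (n * sumL ω (inc v) + (- n) * sumL ω (out v)) + pair (d* Γ ω) F
      ≡⟨ cong (_+ _) (distrib n (sumL ω (inc v)) (sumL ω (out v))) ⟩
    n * d* Γ ω v + pair (d* Γ ω) F ∎
    where
    ins outs : ZE Γ
    ins  = map (n ,_) (inc v)
    outs = map (- n ,_) (out v)
    distrib : ∀ n a b → n * a + (- n) * b ≡ n * (a - b)
    distrib = solve-∀

  star : V → ZE Γ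
  star v = ∂* Γ ((1ℤ , v) ∷ [])

  d*-as-pair : ∀ (ω : E → ℤ) v → d* Γ ω v ≡ pair ω (star v)
  d*-as-pair ω v = sym (begin
    pair ω (star v)                 ≡⟨ pair-∂* ω ((1ℤ , v) ∷ []) ⟩
    1ℤ * d* Γ ω v + 0ℤ              ≡⟨ +-identityʳ _ ⟩
    1ℤ * d* Γ ω v                   ≡⟨ *-identityˡ _ ⟩
    d* Γ ω v                        ∎)

  d*-cong : ∀ {ω ω' : E → ℤ} → (∀ e → ω e ≡ ω' e) → ∀ v → d* Γ ω v ≡ d* Γ ω' v
  d*-cong {ω} {ω'} eq v = begin
    d* Γ ω v          ≡⟨ d*-as-pair ω v ⟩
    pair ω (star v)   ≡⟨ pair-cong (star v) eq ⟩
    pair ω' (star v)  ≡⟨ sym (d*-as-pair ω' v) ⟩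
    d* Γ ω' v         ∎

  d*-+ : ∀ (ω ω' : E → ℤ) v → d* Γ (λ e → ω e + ω' e) v ≡ d* Γ ω v + d* Γ ω' v
  d*-+ ω ω' v = begin
    d* Γ (λ e → ω e + ω' e) v           ≡⟨ d*-as-pair _ v ⟩
    pair (λ e → ω e + ω' e) (star v)    ≡⟨ pair-+ ω ω' (star v) ⟩
    pair ω (star v) + pair ω' (star v)  ≡⟨ sym (cong₂ _+_ (d*-as-pair ω v) (d*-as-pair ω' v)) ⟩
    d* Γ ω v + d* Γ ω' v                ∎

  d*-* : ∀ k (ω : E → ℤ) v → d* Γ (λ e → k * ω e) v ≡ k * d* Γ ω v
  d*-* k ω v = begin
    d* Γ (λ e → k * ω e) v         ≡⟨ d*-as-pair _ v ⟩
    pair (λ e → k * ω e) (star v)  ≡⟨ pair-* k ω (star v) ⟩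
    k * pair ω (star v)            ≡⟨ sym (cong (k *_) (d*-as-pair ω v)) ⟩
    k * d* Γ ω v                   ∎

  d*-zero : ∀ v → d* Γ (λ _ → 0ℤ) v ≡ 0ℤ
  d*-zero v = trans (d*-as-pair _ v) (pair-zero (star v))

  d*-pair : ∀ {A : Set} (g : A → E → ℤ) D v →
            d* Γ (λ e → pair (λ a → g a e) D) v ≡ pair (λ a → d* Γ (g a) v) D
  d*-pair g D v = begin
    d* Γ (λ e → pair (λ a → g a e) D) v         ≡⟨ d*-as-pair _ v ⟩
    pair (λ e → pair (λ a → g a e) D) (star v)  ≡⟨ sym (pair-comm g D (star v)) ⟩
    pair (λ a → pair (g a) (star v)) D          ≡⟨ pair-cong D (λ a → sym (d*-as-pair (g a) v)) ⟩
    pair (λ a → d* Γ (g a) v) D                 ∎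

  □₀-cong : ∀ {f g : V → ℤ} → (∀ v → f v ≡ g v) → ∀ v → □₀ Γ f v ≡ □₀ Γ g v
  □₀-cong eq = d*-cong (λ e → cong₂ _-_ (eq (t e)) (eq (o e)))

  sumL-δ-incident : (end : E → V) (edges : V → List E) →
                    (∀ v → Unique (edges v)) → (∀ e → e ∈ edges (end e)) →
                    (∀ v e → e ∈ edges v → end e ≡ v) →
                    ∀ e v → sumL (OnE.δ e) (edges v) ≡ OnV.δ (end e) v
  sumL-δ-incident end edges unique complete sound e v = by-cases (_≟V_ Γ (end e) v)
    where
    by-cases : Dec (end e ≡ v) → sumL (OnE.δ e) (edges v) ≡ OnV.δ (end e) v
    by-cases (yes refl) = trans (OnE.sumL-δ-∈ (edges v) (unique v) (complete e)) (sym (OnV.δ-≡ refl))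
    by-cases (no  e↛v)  = trans (OnE.sumL-δ-∉ (edges v) (e↛v ∘ sound v e)) (sym (OnV.δ-≢ e↛v))

  d*-δ : ∀ e v → d* Γ (OnE.δ e) v ≡ d Γ (λ u → OnV.δ u v) e
  d*-δ e v = cong₂ _-_ (sumL-δ-incident t inc inc-unique inc-complete inc-sound e v)
                       (sumL-δ-incident o out out-unique out-complete out-sound e v)

  ι₀-∂ : ∀ x v → ι₀ Γ (∂ Γ x) v ≡ pair (d Γ (λ u → OnV.δ u v)) x
  ι₀-∂ x v = trans (OnV.coeff-δ (∂ Γ x) v) (pair-∂ _ x)

  ι₀-as-pair : ∀ F u → ι₀ Γ F u ≡ pair (OnV.δ u) F
  ι₀-as-pair F u = trans (OnV.coeff-δ F u) (pair-cong F (λ y → OnV.δ-sym y u))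

  d*-ι₁ : ∀ x v → d* Γ (ι₁ Γ x) v ≡ ι₀ Γ (∂ Γ x) v
  d*-ι₁ x v = begin
    d* Γ (ι₁ Γ x) v                              ≡⟨ d*-cong (OnE.coeff-δ x) v ⟩
    d* Γ (λ e → pair (λ e' → OnE.δ e' e) x) v    ≡⟨ d*-pair OnE.δ x v ⟩
    pair (λ e' → d* Γ (OnE.δ e') v) x            ≡⟨ pair-cong x (λ e' → d*-δ e' v) ⟩
    pair (d Γ (λ u → OnV.δ u v)) x               ≡⟨ sym (ι₀-∂ x v) ⟩
    ι₀ Γ (∂ Γ x) v                               ∎

  ι₁-∂* : ∀ F e → ι₁ Γ (∂* Γ F) e ≡ d Γ (ι₀ Γ F) e
  ι₁-∂* F e = begin
    ι₁ Γ (∂* Γ F) e                                     ≡⟨ OnE.coeff-δ (∂* Γ F) e ⟩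
    pair (λ e' → OnE.δ e' e) (∂* Γ F)                   ≡⟨ pair-∂* _ F ⟩
    pair (d* Γ (λ e' → OnE.δ e' e)) F                   ≡⟨ pair-cong F δ-boundary ⟩
    pair (λ v → OnV.δ (t e) v - OnV.δ (o e) v) F        ≡⟨ pair-− _ _ F ⟩
    pair (OnV.δ (t e)) F - pair (OnV.δ (o e)) F         ≡⟨ sym (cong₂ _-_ (ι₀-as-pair F (t e)) (ι₀-as-pair F (o e))) ⟩
    d Γ (ι₀ Γ F) e                                      ∎
    where
    δ-boundary : ∀ v → d* Γ (λ e' → OnE.δ e' e) v ≡ OnV.δ (t e) v - OnV.δ (o e) v
    δ-boundary v = trans (d*-cong (λ e' → OnE.δ-sym e' e) v) (d*-δ e v)

  ι₀-Δ₀ : ∀ F v → ι₀ Γ (Δ₀ Γ F) v ≡ □₀ Γ (ι₀ Γ F) v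
  ι₀-Δ₀ F v = trans (sym (d*-ι₁ (∂* Γ F) v)) (d*-cong (ι₁-∂* F) v)

  ι-respects-~ : ∀ D D' → _~Cl_ Γ D D' → _~Ĉl_ Γ (ι₀ Γ D) (ι₀ Γ D')
  ι-respects-~ D D' (F , D≡D'+Δ₀F) =
    ι₀ Γ F , λ v → trans (D≡D'+Δ₀F v) (cong (ι₀ Γ D' v +_) (ι₀-Δ₀ F v))

  ≗⇒~Ĉl : ∀ {f g : V → ℤ} → (∀ v → f v ≡ g v) → _~Ĉl_ Γ f g
  ≗⇒~Ĉl {f} {g} f≗g =
    (λ _ → 0ℤ) , λ v → trans (f≗g v) (sym (trans (cong (g v +_) (d*-zero v)) (+-identityʳ (g v))))

  ι₁-harmonic : ∀ c → InH₁ Γ c → Harmonic Γ (ι₁ Γ c)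
  ι₁-harmonic c c∈H₁ v = trans (d*-ι₁ c v) (c∈H₁ v)

  pair-d-H₁ : ∀ (f : V → ℤ) c → InH₁ Γ c → pair (d Γ f) c ≡ 0ℤ
  pair-d-H₁ f c c∈H₁ = trans (sym (pair-∂ f c)) (OnV.pair-null f (∂ Γ c) c∈H₁)

  extend-H₁ : ∀ {A : Set} (f : A → ZE Γ) → (∀ a → InH₁ Γ (f a)) → ∀ D → InH₁ Γ (extend f D)
  extend-H₁ f f∈H₁ D v = begin
    ι₀ Γ (∂ Γ (extend f D)) v           ≡⟨ ι₀-∂ (extend f D) v ⟩
    pair (d Γ δv) (extend f D)          ≡⟨ pair-extend (d Γ δv) f D ⟩
    pair (λ a → pair (d Γ δv) (f a)) D  ≡⟨ pair-cong D (λ a → trans (sym (ι₀-∂ (f a) v)) (f∈H₁ a v)) ⟩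
    pair (λ _ → 0ℤ) D                   ≡⟨ pair-zero D ⟩
    0ℤ                                  ∎
    where δv = λ u → OnV.δ u v

  deg-∂ : ∀ x → deg (∂ Γ x) ≡ 0ℤ
  deg-∂ x = begin
    deg (∂ Γ x)                 ≡⟨ sym (*-identityʳ _) ⟩
    deg (∂ Γ x) * 1ℤ            ≡⟨ sym (pair-const 1ℤ (∂ Γ x)) ⟩
    pair (λ _ → 1ℤ) (∂ Γ x)     ≡⟨ pair-∂ _ x ⟩
    pair (λ _ → 0ℤ) x           ≡⟨ pair-zero x ⟩
    0ℤ                          ∎

  harmonic-cong : ∀ {η η' : E → ℤ} → (∀ e → η e ≡ η' e) → Harmonic Γ η → Harmonic Γ η'
  harmonic-cong eq harmonic v = trans (sym (d*-cong eq v)) (harmonic v)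

  harmonic-+ : ∀ {η η' : E → ℤ} → Harmonic Γ η → Harmonic Γ η' → Harmonic Γ (λ e → η e + η' e)
  harmonic-+ {η} {η'} h h' v = trans (d*-+ η η' v) (cong₂ _+_ (h v) (h' v))

  harmonic-* : ∀ k {η : E → ℤ} → Harmonic Γ η → Harmonic Γ (λ e → k * η e)
  harmonic-* k {η} h v = trans (d*-* k η v) (trans (cong (k *_) (h v)) (*-zeroʳ k))

  module _ (Φ : HarmDual Γ) where

    φ-zero : ∀ η (h : Harmonic Γ η) → (∀ e → η e ≡ 0ℤ) → φ Φ η h ≡ 0ℤ
    φ-zero η h η≡0 = identityˡ-unique (φ Φ η h) (φ Φ η h) (begin
      φ Φ η h + φ Φ η h              ≡⟨ sym (φ-add Φ η η h h h+h) ⟩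
      φ Φ (λ e → η e + η e) h+h      ≡⟨ φ-ext Φ _ η h+h h (λ e → trans (cong (_+ η e) (η≡0 e)) (+-identityˡ (η e))) ⟩
      φ Φ η h                        ∎)
      where h+h = harmonic-+ h h

    φ-neg : ∀ η (h : Harmonic Γ η) (h' : Harmonic Γ (λ e → - η e)) → φ Φ (λ e → - η e) h' ≡ - φ Φ η h
    φ-neg η h h' = inverseʳ-unique (φ Φ η h) (φ Φ (λ e → - η e) h') (begin
      φ Φ η h + φ Φ (λ e → - η e) h'   ≡⟨ sym (φ-add Φ η _ h h' h-η) ⟩
      φ Φ (λ e → η e - η e) h-η        ≡⟨ φ-zero _ h-η (λ e → +-inverseʳ (η e)) ⟩
      0ℤ                               ∎)
      where h-η = harmonic-+ h h'

    φ-ℕ* : ∀ m η (h : Harmonic Γ η) (h' : Harmonic Γ (λ e → ℤ.+ m * η e)) →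
           φ Φ (λ e → ℤ.+ m * η e) h' ≡ ℤ.+ m * φ Φ η h
    φ-ℕ* ℕ.zero    η h h' = φ-zero _ h' (λ _ → refl)
    φ-ℕ* (ℕ.suc m) η h h' = begin
      φ Φ (λ e → ℤ.+ ℕ.suc m * η e) h'    ≡⟨ φ-ext Φ _ _ h' h+mh (λ e → suc-* (ℤ.+ m) (η e)) ⟩
      φ Φ (λ e → η e + ℤ.+ m * η e) h+mh  ≡⟨ φ-add Φ η _ h mh h+mh ⟩
      φ Φ η h + φ Φ _ mh                  ≡⟨ cong (φ Φ η h +_) (φ-ℕ* m η h mh) ⟩
      φ Φ η h + ℤ.+ m * φ Φ η h           ≡⟨ sym (suc-* (ℤ.+ m) (φ Φ η h)) ⟩
      ℤ.+ ℕ.suc m * φ Φ η h               ∎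
      where
      mh   = harmonic-* (ℤ.+ m) h
      h+mh = harmonic-+ h mh

    φ-* : ∀ k η (h : Harmonic Γ η) (h' : Harmonic Γ (λ e → k * η e)) →
          φ Φ (λ e → k * η e) h' ≡ k * φ Φ η h
    φ-* (ℤ.+ m)  η h h' = φ-ℕ* m η h h'
    φ-* -[1+ m ] η h h' = begin
      φ Φ (λ e → -[1+ m ] * η e) h'       ≡⟨ φ-ext Φ _ _ h' h-mη (λ e → sym (neg-distribˡ-* m' (η e))) ⟩
      φ Φ (λ e → - (m' * η e)) h-mη       ≡⟨ φ-neg _ mη h-mη ⟩
      - φ Φ (λ e → m' * η e) mη           ≡⟨ cong -_ (φ-ℕ* (ℕ.suc m) η h mη) ⟩
      - (m' * φ Φ η h)                    ≡⟨ neg-distribˡ-* m' (φ Φ η h) ⟩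
      -[1+ m ] * φ Φ η h                  ∎
      where
      m'   = ℤ.+ ℕ.suc m
      mη   = harmonic-* m' h
      h-mη = harmonic-cong (λ e → sym (neg-distribˡ-* m' (η e))) h'

    φ-ι₁-extend : ∀ {A : Set} (f : A → ZE Γ) (f∈H₁ : ∀ a → InH₁ Γ (f a)) D →
                  φ Φ (ι₁ Γ (extend f D)) (ι₁-harmonic (extend f D) (extend-H₁ f f∈H₁ D))
                    ≡ pair (λ a → φ Φ (ι₁ Γ (f a)) (ι₁-harmonic (f a) (f∈H₁ a))) D
    φ-ι₁-extend f f∈H₁ []            = φ-zero _ _ (λ _ → refl)
    φ-ι₁-extend f f∈H₁ ((n , a) ∷ D) = begin
      φ Φ (ι₁ Γ (scale n (f a) ++ extend f D)) _   ≡⟨ φ-ext Φ _ _ _ hnfa+rest ι₁-cons ⟩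
      φ Φ (λ x → n * fa x + rest x) hnfa+rest      ≡⟨ φ-add Φ _ _ hnfa hrest hnfa+rest ⟩
      φ Φ (λ x → n * fa x) hnfa + φ Φ rest hrest   ≡⟨ cong₂ _+_ (φ-* n fa hfa hnfa) (φ-ι₁-extend f f∈H₁ D) ⟩
      n * φ Φ fa hfa + pair (λ a → φ Φ (ι₁ Γ (f a)) (ι₁-harmonic (f a) (f∈H₁ a))) D ∎
      where
      fa rest : E → ℤ
      fa        = ι₁ Γ (f a)
      rest      = ι₁ Γ (extend f D)
      hfa       = ι₁-harmonic (f a) (f∈H₁ a)
      hrest     = ι₁-harmonic (extend f D) (extend-H₁ f f∈H₁ D)
      hnfa      = harmonic-* n hfa
      hnfa+rest = harmonic-+ hnfa hrest
      ι₁-cons : ∀ x → ι₁ Γ (scale n (f a) ++ extend f D) x ≡ n * fa x + rest x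
      ι₁-cons x = trans (OnE.coeff-++ (scale n (f a)) (extend f D) x)
                        (cong (_+ rest x) (OnE.coeff-scale n (f a) x))

  chain : ∀ {u w} → Walk Γ u w → ZE Γ
  chain nil       = []
  chain (fwd e p) = (1ℤ , e) ∷ chain p
  chain (bwd e p) = (- 1ℤ , e) ∷ chain p

  pair-d-chain : ∀ (f : V → ℤ) {u w} (p : Walk Γ u w) → pair (d Γ f) (chain p) ≡ f w - f u
  pair-d-chain f {u} nil = sym (+-inverseʳ (f u))
  pair-d-chain f {w = w} (fwd e p) =
    trans (cong ((1ℤ * d Γ f e) +_) (pair-d-chain f p)) (telescope (f (t e)) (f (o e)) (f w))
    where telescope : ∀ a b c → 1ℤ * (a - b) + (c - a) ≡ c - b
          telescope = solve-∀
  pair-d-chain f {w = w} (bwd e p) =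
    trans (cong ((- 1ℤ * d Γ f e) +_) (pair-d-chain f p)) (telescope (f (t e)) (f (o e)) (f w))
    where telescope : ∀ a b c → - 1ℤ * (a - b) + (c - b) ≡ c - a
          telescope = solve-∀

module ConnectedGraph (Γ : Graph) (connected : Connected Γ) where
  open Graph Γ
  open GraphCalculus Γ

  path : V → ZE Γ
  path v = chain (connected base v)

  potential : (E → ℤ) → V → ℤ
  potential ω v = pair ω (path v)

  potential-d : ∀ (f : V → ℤ) v → potential (d Γ f) v ≡ f v - f base
  potential-d f v = pair-d-chain f (connected base v)

  -- e closed up by the chosen paths from the base point to its endpoints.
  cycle : E → ZE Γ
  cycle e = (1ℤ , e) ∷ (neg (path (t e)) ++ path (o e))

  pair-cycle : ∀ ω e → pair ω (cycle e) ≡ ω e - d Γ (potential ω) e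
  pair-cycle ω e = begin
    1ℤ * ω e + pair ω (neg (path (t e)) ++ path (o e))
      ≡⟨ cong ((1ℤ * ω e) +_) (pair-++ ω (neg (path (t e))) (path (o e))) ⟩
    1ℤ * ω e + (pair ω (neg (path (t e))) + potential ω (o e))
      ≡⟨ cong (λ p → 1ℤ * ω e + (p + potential ω (o e))) (pair-neg ω (path (t e))) ⟩
    1ℤ * ω e + (- potential ω (t e) + potential ω (o e))
      ≡⟨ rearrange (ω e) (potential ω (t e)) (potential ω (o e)) ⟩
    ω e - d Γ (potential ω) e ∎
    where rearrange : ∀ w a b → 1ℤ * w + (- a + b) ≡ w - (a - b)
          rearrange = solve-∀

  cycle-H₁ : ∀ e → InH₁ Γ (cycle e)
  cycle-H₁ e v = begin
    ι₀ Γ (∂ Γ (cycle e)) v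
      ≡⟨ ι₀-∂ (cycle e) v ⟩
    pair (d Γ δv) (cycle e)
      ≡⟨ pair-cycle (d Γ δv) e ⟩
    d Γ δv e - d Γ (potential (d Γ δv)) e
      ≡⟨ cong₂ (λ a b → d Γ δv e - (a - b)) (potential-d δv (t e)) (potential-d δv (o e)) ⟩
    d Γ δv e - ((δv (t e) - δv base) - (δv (o e) - δv base))
      ≡⟨ cancel (δv (t e)) (δv (o e)) (δv base) ⟩
    0ℤ ∎
    where
    δv = λ u → OnV.δ u v
    cancel : ∀ a b c → (a - b) - ((a - c) - (b - c)) ≡ 0ℤ
    cancel = solve-∀

  -- Injectivity of H¹ → Hom(H₁, ℤ).
  agree-on-H₁⇒cohomologous : ∀ (ω η : E → ℤ) → (∀ c → InH₁ Γ c → pair ω c ≡ pair η c) →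
                             ∀ e → ω e ≡ η e + d Γ (λ v → potential ω v - potential η v) e
  agree-on-H₁⇒cohomologous ω η agree e =
    solve-for-ω (ω e) (η e) (potential ω (t e)) (potential ω (o e)) (potential η (t e)) (potential η (o e))
      (begin
        ω e - d Γ (potential ω) e   ≡⟨ sym (pair-cycle ω e) ⟩
        pair ω (cycle e)            ≡⟨ agree (cycle e) (cycle-H₁ e) ⟩
        pair η (cycle e)            ≡⟨ pair-cycle η e ⟩
        η e - d Γ (potential η) e   ∎)
    where
    solve-for-ω : ∀ w h a b a' b' → w - (a - b) ≡ h - (a' - b') → w ≡ h + ((a - a') - (b - b'))
    solve-for-ω w h a b a' b' eq =
      trans (shift w a b) (trans (cong (_+ (a - b)) eq) (collect h a b a' b'))
      where
      shift : ∀ w a b → w ≡ (w - (a - b)) + (a - b)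
      shift = solve-∀
      collect : ∀ h a b a' b' → (h - (a' - b')) + (a - b) ≡ h + ((a - a') - (b - b'))
      collect = solve-∀

  ι₁-extend-cycle : ∀ c → InH₁ Γ c → ∀ x → ι₁ Γ (extend cycle c) x ≡ ι₁ Γ c x
  ι₁-extend-cycle c c∈H₁ x = begin
    ι₁ Γ (extend cycle c) x                     ≡⟨ OnE.coeff-δ (extend cycle c) x ⟩
    pair δx (extend cycle c)                    ≡⟨ pair-extend δx cycle c ⟩
    pair (λ e → pair δx (cycle e)) c            ≡⟨ pair-cong c (pair-cycle δx) ⟩
    pair (λ e → δx e - d Γ (potential δx) e) c  ≡⟨ pair-− δx _ c ⟩
    pair δx c - pair (d Γ (potential δx)) c     ≡⟨ cong (λ p → pair δx c - p) (pair-d-H₁ (potential δx) c c∈H₁) ⟩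
    pair δx c - 0ℤ                              ≡⟨ +-identityʳ _ ⟩
    pair δx c                                   ≡⟨ sym (OnE.coeff-δ c x) ⟩
    ι₁ Γ c x                                    ∎
    where δx = λ y → OnE.δ y x

  fill : ZV Γ → ZE Γ
  fill = extend path

  ι₀-∂-fill : ∀ D v → ι₀ Γ (∂ Γ (fill D)) v ≡ ι₀ Γ D v - deg D * OnV.δ base v
  ι₀-∂-fill D v = begin
    ι₀ Γ (∂ Γ (fill D)) v                        ≡⟨ ι₀-∂ (fill D) v ⟩
    pair (d Γ δv) (fill D)                       ≡⟨ pair-extend (d Γ δv) path D ⟩
    pair (λ u → potential (d Γ δv) u) D          ≡⟨ pair-cong D (potential-d δv) ⟩
    pair (λ u → δv u - δv base) D                ≡⟨ pair-− δv _ D ⟩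
    pair δv D - pair (λ _ → δv base) D           ≡⟨ cong₂ _-_ (sym (OnV.coeff-δ D v)) (pair-const (δv base) D) ⟩
    ι₀ Γ D v - deg D * δv base                   ∎
    where δv = λ u → OnV.δ u v

  deg≡0⇒ι₀∈im-d* : ∀ D → deg D ≡ 0ℤ → InImD* Γ (ι₀ Γ D)
  deg≡0⇒ι₀∈im-d* D deg≡0 = ι₁ Γ (fill D) , λ v → begin
    d* Γ (ι₁ Γ (fill D)) v                  ≡⟨ d*-ι₁ (fill D) v ⟩
    ι₀ Γ (∂ Γ (fill D)) v                   ≡⟨ ι₀-∂-fill D v ⟩
    ι₀ Γ D v - deg D * OnV.δ base v         ≡⟨ cong (λ k → ι₀ Γ D v - k * OnV.δ base v) deg≡0 ⟩
    ι₀ Γ D v - 0ℤ                           ≡⟨ +-identityʳ _ ⟩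
    ι₀ Γ D v                                ∎

  ζ-rep : HarmDual Γ → E → ℤ
  ζ-rep Φ e = φ Φ (ι₁ Γ (cycle e)) (ι₁-harmonic (cycle e) (cycle-H₁ e))

  ζ-rep-ZetaRel : ∀ Φ → ZetaRel Γ Φ (ζ-rep Φ)
  ζ-rep-ZetaRel Φ c c∈H₁ h = begin
    pair (ζ-rep Φ) c                      ≡⟨ sym (φ-ι₁-extend Φ cycle cycle-H₁ c) ⟩
    φ Φ (ι₁ Γ (extend cycle c)) _         ≡⟨ φ-ext Φ _ _ _ h (ι₁-extend-cycle c c∈H₁) ⟩
    φ Φ (ι₁ Γ c) h                        ∎

  ζ-respects-~J : ∀ Φ Ψ ω ω' → _~J_ Γ Φ Ψ → ZetaRel Γ Φ ω → ZetaRel Γ Ψ ω' → _~P_ Γ ω ω'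
  ζ-respects-~J Φ Ψ ω ω' (c₀ , c₀∈H₁ , Φ≈Ψ+c₀) zΦ zΨ =
    f , ι₁ Γ c₀ , ι₁-harmonic c₀ c₀∈H₁ , λ e →
      trans (agree-on-H₁⇒cohomologous ω η agree e) (swap (ω' e) (ι₁ Γ c₀ e) (d Γ f e))
    where
    η : E → ℤ
    η e = ω' e + ι₁ Γ c₀ e
    f : V → ℤ
    f v = potential ω v - potential η v
    swap : ∀ a b c → (a + b) + c ≡ (a + c) + b
    swap = solve-∀
    agree : ∀ c → InH₁ Γ c → pair ω c ≡ pair η c
    agree c c∈H₁ = begin
      pair ω c                          ≡⟨ zΦ c c∈H₁ h ⟩
      φ Φ (ι₁ Γ c) h                    ≡⟨ Φ≈Ψ+c₀ (ι₁ Γ c) h ⟩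
      φ Ψ (ι₁ Γ c) h + pair (ι₁ Γ c) c₀ ≡⟨ cong₂ _+_ (sym (zΨ c c∈H₁ h)) (OnE.pair-coeff-comm c c₀) ⟩
      pair ω' c + pair (ι₁ Γ c₀) c      ≡⟨ sym (pair-+ ω' (ι₁ Γ c₀) c) ⟩
      pair η c                          ∎
      where h = ι₁-harmonic c c∈H₁

  χ∘ζ∘AJ≈ι⁰ : ∀ γ Φ ω → RepAJ Γ γ Φ → ZetaRel Γ Φ ω → _~Ĉl_ Γ (d* Γ ω) (ι₀ Γ (∂ Γ γ))
  χ∘ζ∘AJ≈ι⁰ γ Φ ω (c₀ , c₀∈H₁ , Φ≈γ+c₀) z = f , λ v → begin
    d* Γ ω v                                ≡⟨ d*-cong (agree-on-H₁⇒cohomologous ω η agree) v ⟩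
    d* Γ (λ e → η e + d Γ f e) v            ≡⟨ d*-+ η (d Γ f) v ⟩
    d* Γ η v + □₀ Γ f v                     ≡⟨ cong (_+ □₀ Γ f v) (d*-+ (ι₁ Γ γ) (ι₁ Γ c₀) v) ⟩
    (d* Γ (ι₁ Γ γ) v + d* Γ (ι₁ Γ c₀) v) + □₀ Γ f v
      ≡⟨ cong (_+ □₀ Γ f v) (cong₂ _+_ (d*-ι₁ γ v) (ι₁-harmonic c₀ c₀∈H₁ v)) ⟩
    (ι₀ Γ (∂ Γ γ) v + 0ℤ) + □₀ Γ f v        ≡⟨ cong (_+ □₀ Γ f v) (+-identityʳ (ι₀ Γ (∂ Γ γ) v)) ⟩
    ι₀ Γ (∂ Γ γ) v + □₀ Γ f v               ∎
    where
    η : E → ℤ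
    η e = ι₁ Γ γ e + ι₁ Γ c₀ e
    f : V → ℤ
    f v = potential ω v - potential η v
    agree : ∀ c → InH₁ Γ c → pair ω c ≡ pair η c
    agree c c∈H₁ = begin
      pair ω c                                      ≡⟨ z c c∈H₁ h ⟩
      φ Φ (ι₁ Γ c) h                                ≡⟨ Φ≈γ+c₀ (ι₁ Γ c) h ⟩
      pair (ι₁ Γ c) γ + pair (ι₁ Γ c) c₀            ≡⟨ cong₂ _+_ (OnE.pair-coeff-comm c γ) (OnE.pair-coeff-comm c c₀) ⟩
      pair (ι₁ Γ γ) c + pair (ι₁ Γ c₀) c            ≡⟨ sym (pair-+ (ι₁ Γ γ) (ι₁ Γ c₀) c) ⟩
      pair η c                                      ∎
      where h = ι₁-harmonic c c∈H₁

module FiniteGraph (Γ : Graph) (finite : Finite Γ) where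
  open Graph Γ
  open GraphCalculus Γ

  toDivisor : (V → ℤ) → ZV Γ
  toDivisor f = OnV.fromFunction f (proj₁ (proj₁ finite))

  ι₀-toDivisor : ∀ f v → ι₀ Γ (toDivisor f) v ≡ f v
  ι₀-toDivisor f v = OnV.coeff-fromFunction f _ (proj₂ (proj₁ finite) v)

  toChain : (E → ℤ) → ZE Γ
  toChain ω = OnE.fromFunction ω (proj₁ (proj₂ finite))

  ι₁-toChain : ∀ ω e → ι₁ Γ (toChain ω) e ≡ ω e
  ι₁-toChain ω e = OnE.coeff-fromFunction ω _ (proj₂ (proj₂ finite) e)

  toChain-H₁ : ∀ θ → Harmonic Γ θ → InH₁ Γ (toChain θ)
  toChain-H₁ θ θ-harmonic v = begin
    ι₀ Γ (∂ Γ (toChain θ)) v    ≡⟨ sym (d*-ι₁ (toChain θ) v) ⟩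
    d* Γ (ι₁ Γ (toChain θ)) v   ≡⟨ d*-cong (ι₁-toChain θ) v ⟩
    d* Γ θ v                    ≡⟨ θ-harmonic v ⟩
    0ℤ                          ∎

  pair-toChain-comm : ∀ ω η → pair ω (toChain η) ≡ pair η (toChain ω)
  pair-toChain-comm ω η = begin
    pair ω (toChain η)                  ≡⟨ pair-cong (toChain η) (λ e → sym (ι₁-toChain ω e)) ⟩
    pair (ι₁ Γ (toChain ω)) (toChain η) ≡⟨ OnE.pair-coeff-comm (toChain ω) (toChain η) ⟩
    pair (ι₁ Γ (toChain η)) (toChain ω) ≡⟨ pair-cong (toChain ω) (ι₁-toChain η) ⟩
    pair η (toChain ω)                  ∎

  ι-surjective : ∀ f → Σ (ZV Γ) λ D → _~Ĉl_ Γ (ι₀ Γ D) f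
  ι-surjective f = toDivisor f , ≗⇒~Ĉl (ι₀-toDivisor f)

  ι-injective : ∀ D D' → _~Ĉl_ Γ (ι₀ Γ D) (ι₀ Γ D') → _~Cl_ Γ D D'
  ι-injective D D' (h , D≡D'+□₀h) = toDivisor h , λ v → begin
    ι₀ Γ D v                                 ≡⟨ D≡D'+□₀h v ⟩
    ι₀ Γ D' v + □₀ Γ h v                     ≡⟨ cong (ι₀ Γ D' v +_) (□₀-cong (λ u → sym (ι₀-toDivisor h u)) v) ⟩
    ι₀ Γ D' v + □₀ Γ (ι₀ Γ (toDivisor h)) v  ≡⟨ cong (ι₀ Γ D' v +_) (sym (ι₀-Δ₀ (toDivisor h) v)) ⟩
    ι₀ Γ D' v + ι₀ Γ (Δ₀ Γ (toDivisor h)) v  ∎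

  ι⁰-surjective : ∀ f → InImD* Γ f → Σ (ZV Γ) λ D → (deg D ≡ 0ℤ) × _~Ĉl_ Γ (ι₀ Γ D) f
  ι⁰-surjective f (ω , d*ω≡f) = ∂ Γ (toChain ω) , deg-∂ (toChain ω) , ≗⇒~Ĉl λ v → begin
    ι₀ Γ (∂ Γ (toChain ω)) v    ≡⟨ sym (d*-ι₁ (toChain ω) v) ⟩
    d* Γ (ι₁ Γ (toChain ω)) v   ≡⟨ d*-cong (ι₁-toChain ω) v ⟩
    d* Γ ω v                    ≡⟨ d*ω≡f v ⟩
    f v                         ∎

  ζ-surjective : ∀ ω → Σ (HarmDual Γ) λ Φ → ZetaRel Γ Φ ω
  ζ-surjective ω = Φ , λ c _ _ → begin
    pair ω c                 ≡⟨ pair-cong c (λ e → sym (ι₁-toChain ω e)) ⟩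
    pair (ι₁ Γ ω̂) c          ≡⟨ OnE.pair-coeff-comm ω̂ c ⟩
    pair (ι₁ Γ c) ω̂          ∎
    where
    ω̂ = toChain ω
    Φ : HarmDual Γ
    Φ = record { φ     = λ η _ → pair η ω̂
               ; φ-ext = λ _ _ _ _ η≗η' → pair-cong ω̂ η≗η'
               ; φ-add = λ η η' _ _ _ → pair-+ η η' ω̂
               }

  ζ-injective : ∀ Φ Ψ ω ω' → ZetaRel Γ Φ ω → ZetaRel Γ Ψ ω' → _~P_ Γ ω ω' → _~J_ Γ Φ Ψ
  ζ-injective Φ Ψ ω ω' zΦ zΨ (f , η , η-harmonic , ω≡ω'+df+η) =
    toChain η , toChain-H₁ η η-harmonic , Φ≈Ψ+η
    where
    Φ≈Ψ+η : ∀ θ (h : Harmonic Γ θ) → φ Φ θ h ≡ φ Ψ θ h + pair θ (toChain η)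
    Φ≈Ψ+η θ h = begin
      φ Φ θ h                                          ≡⟨ φ-ext Φ _ _ h hθ̂ (λ e → sym (ι₁-toChain θ e)) ⟩
      φ Φ (ι₁ Γ θ̂) hθ̂                                  ≡⟨ sym (zΦ θ̂ θ̂∈H₁ hθ̂) ⟩
      pair ω θ̂                                         ≡⟨ pair-cong θ̂ ω≡ω'+df+η ⟩
      pair (λ e → ω' e + d Γ f e + η e) θ̂              ≡⟨ pair-+ _ η θ̂ ⟩
      pair (λ e → ω' e + d Γ f e) θ̂ + pair η θ̂         ≡⟨ cong (_+ pair η θ̂) (pair-+ ω' (d Γ f) θ̂) ⟩
      (pair ω' θ̂ + pair (d Γ f) θ̂) + pair η θ̂          ≡⟨ cong₂ (λ a b → (a + b) + pair η θ̂) (zΨ θ̂ θ̂∈H₁ hθ̂) (pair-d-H₁ f θ̂ θ̂∈H₁) ⟩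
      (φ Ψ (ι₁ Γ θ̂) hθ̂ + 0ℤ) + pair η θ̂                ≡⟨ cong (_+ pair η θ̂) (+-identityʳ (φ Ψ (ι₁ Γ θ̂) hθ̂)) ⟩
      φ Ψ (ι₁ Γ θ̂) hθ̂ + pair η θ̂                       ≡⟨ cong₂ _+_ (φ-ext Ψ _ _ hθ̂ h (ι₁-toChain θ)) (pair-toChain-comm η θ) ⟩
      φ Ψ θ h + pair θ (toChain η)                     ∎
      where
      θ̂    = toChain θ
      θ̂∈H₁ = toChain-H₁ θ h
      hθ̂   = ι₁-harmonic θ̂ θ̂∈H₁

theorem2p4p7 : (Γ : Graph) → Connected Γ →
    (∀ D D' v → ι₀ Γ (D ++ D') v ≡ ι₀ Γ D v + ι₀ Γ D' v)
    × (∀ D D' → _~Cl_ Γ D D' → _~Ĉl_ Γ (ι₀ Γ D) (ι₀ Γ D'))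
    × (∀ D → deg D ≡ 0ℤ → InImD* Γ (ι₀ Γ D))
    × (∀ Φ → Σ _ λ ω → ZetaRel Γ Φ ω)
    × (∀ Φ Ψ ω ω' → _~J_ Γ Φ Ψ → ZetaRel Γ Φ ω → ZetaRel Γ Ψ ω' → _~P_ Γ ω ω')
    × (∀ γ Φ ω → RepAJ Γ γ Φ → ZetaRel Γ Φ ω →
         _~Ĉl_ Γ (d* Γ ω) (ι₀ Γ (∂ Γ γ)))
    × (Finite Γ →
         (∀ f → Σ _ λ D → _~Ĉl_ Γ (ι₀ Γ D) f)
       × (∀ D D' → _~Ĉl_ Γ (ι₀ Γ D) (ι₀ Γ D') → _~Cl_ Γ D D')
       × (∀ f → InImD* Γ f → Σ _ λ D → (deg D ≡ 0ℤ) × _~Ĉl_ Γ (ι₀ Γ D) f)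
       × (∀ D D' → deg D ≡ 0ℤ → deg D' ≡ 0ℤ →
            _~Ĉl_ Γ (ι₀ Γ D) (ι₀ Γ D') → _~Cl_ Γ D D')
       × (∀ ω → Σ _ λ Φ → ZetaRel Γ Φ ω)
       × (∀ Φ Ψ ω ω' → ZetaRel Γ Φ ω → ZetaRel Γ Ψ ω' → _~P_ Γ ω ω' → _~J_ Γ Φ Ψ))
theorem2p4p7 Γ connected =
    OnV.coeff-++
  , ι-respects-~
  , deg≡0⇒ι₀∈im-d*
  , (λ Φ → ζ-rep Φ , ζ-rep-ZetaRel Φ)
  , ζ-respects-~J
  , χ∘ζ∘AJ≈ι⁰
  , λ finite → let open FiniteGraph Γ finite in
        ι-surjective
      , ι-injective
      , ι⁰-surjective
      , (λ D D' _ _ → ι-injective D D')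
      , ζ-surjective
      , ζ-injective
  where
  open GraphCalculus Γ
  open ConnectedGraph Γ connected
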